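{- Let $(C,\phi)$ be a multistate monotone system with component state sets $\mathcal{S}_i=\{0,1,\ldots,m_i\}$, $m_i\ge1$, and $k\in\{1,\ldots,M\}$. Define the binary monotone system $(C,\psi_k)$ by $\psi_k(\bm{z})=\phi_k(\bm{m}-\bm{1}+\bm{z})$ for $\bm{z}\in\{0,1\}^n$. Then $d(\phi_k)=d(\psi_k)$.
   Context: A multistate monotone system (MMS) $(C,\phi)$ has component set $C=\{1,\ldots,n\}$, component state sets $\mathcal{S}_i=\{0,1,\ldots,m_i\}$, component state space $\mathfrak{C}=\mathcal{S}_1\times\cdots\times\mathcal{S}_n$, system state set $\{0,1,\ldots,M\}$, and a structure function $\phi:\mathfrak{C}\to\{0,\ldots,M\}$ non-decreasing in each argument; $\phi_k(\bm{x})=\mathrm{I}(\phi(\bm{x})\ge k)$; $\bm{m}=(m_1,\ldots,m_n)$, $\bm{1}=(1,\ldots,1)$. Vectors are ordered componentwise. For a binary-valued non-decreasing function $f$ on such a state space, a minimal path vector is $\bm{x}$ with $f(\bm{x})=1$ and $f(\bm{y})=0$ for all $\bm{y}\le\bm{x}$, $\bm{y}\ne\bm{x}$; with $\mathfrak{P}$ the set of these, $\mathrm{cl}(\mathfrak{P})$ is the smallest set containing $\mathfrak{P}$ closed under componentwise maximum. A formation of $\bm{x}\in\mathrm{cl}(\mathfrak{P})$ is a nonempty subset $\{\bm{x}_{i_1},\ldots,\bm{x}_{i_j}\}\subseteq\mathfrak{P}$ whose componentwise maximum is $\bm{x}$, odd/even according to parity of $j$. The signed domination function is $\delta(\bm{x})=$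 (number of odd formations) $-$ (number of even formations) on $\mathrm{cl}(\mathfrak{P})$ and $0$ elsewhere, and the signed domination $d(f)$ is $\delta$ evaluated at the maximal state vector (here $\bm{m}$ for $\phi_k$, and $\bm{1}$ for the binary $\psi_k$, whose component state sets are all $\{0,1\}$). -}

module Defs where

open import Data.Bool using (Bool; true; false; _∧_; not; if_then_else_)
open import Data.Nat using (ℕ; zero; suc; _⊔_; _∸_; _+_; _≤_; _≤ᵇ_)
import Data.Nat as ℕ
open import Data.Integer using (ℤ; 0ℤ; 1ℤ; -1ℤ) renaming (_+_ to _+ℤ_)
open import Data.List using (List; []; _∷_; map; concatMap; upTo; filter; length; _++_)
open import Data.Vec using (Vec; []; _∷_; zipWith; replicate)
open import Data.Vec.Relation.Binary.Pointwise.Inductive using (Pointwise)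
open import Relation.Nullary.Decidable using (⌊_⌋)
open import Data.Vec.Properties using (≡-dec)

_≤v_ : ∀ {n} → Vec ℕ n → Vec ℕ n → Set
_≤v_ = Pointwise _≤_

_≤vᵇ_ : ∀ {n} → Vec ℕ n → Vec ℕ n → Bool
[] ≤vᵇ [] = true
(a ∷ as) ≤vᵇ (b ∷ bs) = (a ≤ᵇ b) ∧ (as ≤vᵇ bs)

_==v_ : ∀ {n} → Vec ℕ n → Vec ℕ n → Bool
x ==v y = ⌊ ≡-dec ℕ._≟_ x y ⌋

-- The state space {0..b_1} × ... × {0..b_n}, enumerated as a list
-- (each vector occurs exactly once).
box : ∀ {n} → Vec ℕ n → List (Vec ℕ n)
box [] = [] ∷ []
box (b ∷ bs) = concatMap (λ a → map (a ∷_) (box bs)) (upTo (suc b))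

maxv : ∀ {n} → Vec ℕ n → Vec ℕ n → Vec ℕ n
maxv = zipWith _⊔_

maxAll : ∀ {n} → List (Vec ℕ n) → Vec ℕ n
maxAll [] = replicate _ 0
maxAll (x ∷ xs) = maxv x (maxAll xs)

allB : ∀ {A : Set} → (A → Bool) → List A → Bool
allB p [] = true
allB p (x ∷ xs) = p x ∧ allB p xs

-- x is a minimal path vector of the binary function f on the state space
-- with maximal vector b: f(x) = 1 and f(y) = 0 for every y ≤ x, y ≠ x
-- (such y automatically lie in the state space).
isMinPath : ∀ {n} → (Vec ℕ n → Bool) → Vec ℕ n → Vec ℕ n → Bool
isMinPath f b x =
  f x ∧ allB (λ y → not ((y ≤vᵇ x) ∧ not (y ==v x) ∧ f y)) (box b)

minPaths : ∀ {n} → (Vec ℕ n → Bool) → Vec ℕ n → List (Vec ℕ n)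
minPaths f b = filter (λ x → Data.Bool._≟_ (isMinPath f b x) true) (box b)
  where import Data.Bool

-- All subsets of a duplicate-free list, as sublists.
sublists : ∀ {A : Set} → List A → List (List A)
sublists [] = [] ∷ []
sublists (x ∷ xs) = sublists xs ++ map (x ∷_) (sublists xs)

isNonEmpty : ∀ {A : Set} → List A → Bool
isNonEmpty [] = false
isNonEmpty (_ ∷ _) = true

isOdd : ℕ → Bool
isOdd zero = false
isOdd (suc k) = not (isOdd k)

-- Contribution of a subset S of 𝔓 to δ(x): +1 if S is an odd formation
-- of x, -1 if S is an even formation of x, 0 if S is not a formation of x.
contribution : ∀ {n} → Vec ℕ n → List (Vec ℕ n) → ℤ
contribution x S =
  if isNonEmpty S ∧ (maxAll S ==v x)
  then (if isOdd (length S) then 1ℤ else -1ℤ)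
  else 0ℤ

sumℤ : List ℤ → ℤ
sumℤ [] = 0ℤ
sumℤ (z ∷ zs) = z +ℤ sumℤ zs

-- Signed domination function δ(x) = #odd formations − #even formations of x
-- (this is 0 automatically when x ∉ cl(𝔓), since then x has no formations).
δ : ∀ {n} → (Vec ℕ n → Bool) → Vec ℕ n → Vec ℕ n → ℤ
δ f b x = sumℤ (map (contribution x) (sublists (minPaths f b)))

d : ∀ {n} → (Vec ℕ n → Bool) → Vec ℕ n → ℤ
d f b = δ f b b

φ[_] : ∀ {n} → ℕ → (Vec ℕ n → ℕ) → Vec ℕ n → Bool
φ[ k ] φ x = k ≤ᵇ φ x

ψ[_] : ∀ {n} → ℕ → (Vec ℕ n → ℕ) → Vec ℕ n → Vec ℕ n → Bool
ψ[ k ] φ m z = φ[ k ] φ (zipWith (λ a c → (a ∸ 1) + c) m z)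

-- For a monotone binary f on the box [0, b] with b ≥ 1, the signed domination is the
-- mixed backward difference d(f) = Σ_{ε ∈ {0,1}ⁿ} (−1)^|ε| f(b − ε).  Indeed a subset S
-- of minimal path vectors contributes ±[max S = b], and [v = b] = ∇[v ≤ ·](b); summing
-- the signed up-set indicators ±[max S ≤ x] over all nonempty S is inclusion–exclusion
-- for "some minimal path vector lies below x", which is f(x).  The difference at m only
-- sees the states m − ε = m − 1 + (1 − ε), so d(φ_k) and d(ψ_k) are the same sum.
module Submission where

open import Defs
open import Data.Bool using (Bool; true; false; T; _∧_; _∨_; not; if_then_else_)
import Data.Bool.Properties as Bool
open import Data.Bool.Properties using (T-∧; T-≡)
open import Data.Bool.ListAction using (any)
open import Data.Empty using (⊥-elim)
open import Data.Integer using (ℤ; 0ℤ; 1ℤ; -1ℤ; _+_; _-_; _*_; -_)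
import Data.Integer.Properties as ℤ
open import Data.Integer.Tactic.RingSolver using (solve-∀)
open import Data.List using (List; []; _∷_; _++_; map; upTo; length)
open import Data.List.Properties using (map-∘; map-cong; map-cong-local)
open import Data.List.Membership.Propositional using (_∈_; find; lose)
open import Data.List.Membership.Propositional.Properties
  using (∈-filter⁺; ∈-filter⁻; ∈-concatMap⁺; ∈-concatMap⁻; ∈-map⁺; ∈-map⁻; ∈-upTo⁺; ∈-upTo⁻)
open import Data.List.Relation.Unary.Any using (here; any?)
open import Data.List.Relation.Unary.Any.Properties using (any⁺; any⁻)
import Data.List.Relation.Unary.All as List
open import Data.List.Relation.Unary.All.Properties using (¬Any⇒All¬; ++⁺; map⁺)
import Data.Nat as ℕ
open import Data.Nat using (ℕ; zero; suc; _∸_; _≤_; _<_; _≤ᵇ_; _≡ᵇ_; z≤n; s≤s)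
open import Data.Nat.Induction using (<-wellFounded)
open import Data.Nat.Properties
  using (≤ᵇ⇒≤; ≤⇒≤ᵇ; ≤-refl; ≤-reflexive; ≤-trans; ≤-pred; ≤∧≢⇒<; ⊔-lub; m≤m⊔n; m≤n⊔m; m∸n≤m;
         +-comm; +-identityʳ; +-mono-≤; +-monoʳ-≤; +-monoʳ-<; +-mono-<-≤)
open import Data.Product using (∃-syntax; _×_; _,_; proj₁; proj₂; uncurry)
open import Data.Unit using (tt)
open import Data.Vec using (Vec; []; _∷_; replicate; zipWith; sum)
open import Data.Vec.Relation.Binary.Pointwise.Inductive as Pointwise using ([]; _∷_)
open import Data.Vec.Relation.Unary.All using (All)
import Data.Vec.Relation.Unary.All as Vec
open import Function using (_∘_; _⇔_; mk⇔; Equivalence)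
open import Induction.WellFounded using (Acc; acc)
open import Relation.Binary.PropositionalEquality
  using (_≡_; _≢_; refl; sym; trans; cong; cong₂; module ≡-Reasoning)
open import Relation.Nullary using (¬_; yes; no)
open import Relation.Nullary.Decidable using (T?; isYes≗does; fromWitness)
open import Relation.Nullary.Reflects using (Reflects; ofʸ; ofⁿ; fromEquivalence; T-reflects; _×-reflects_)

reflects-⇔⇒≡ : ∀ {A B : Set} {a b} → Reflects A a → Reflects B b → A ⇔ B → a ≡ b
reflects-⇔⇒≡ (ofʸ _) (ofʸ _) _ = refl
reflects-⇔⇒≡ (ofⁿ _) (ofⁿ _) _ = refl
reflects-⇔⇒≡ (ofʸ a) (ofⁿ ¬b) A⇔B = ⊥-elim (¬b (Equivalence.to A⇔B a))
reflects-⇔⇒≡ (ofⁿ ¬a) (ofʸ b) A⇔B = ⊥-elim (¬a (Equivalence.from A⇔B b))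

¬T⇒T-not : ∀ {c} → ¬ T c → T (not c)
¬T⇒T-not {false} _ = tt
¬T⇒T-not {true} ¬t = ⊥-elim (¬t tt)

T-not⇒¬T : ∀ {c} → T (not c) → ¬ T c
T-not⇒¬T {false} _ ()

All⇒allB : ∀ {A : Set} {p : A → Bool} {L} → List.All (T ∘ p) L → T (allB p L)
All⇒allB List.[] = tt
All⇒allB (t List.∷ ts) = Equivalence.from T-∧ (t , All⇒allB ts)

≤v-refl : ∀ {n} {x : Vec ℕ n} → x ≤v x
≤v-refl = Pointwise.refl ≤-refl

≤v-trans : ∀ {n} {x y z : Vec ℕ n} → x ≤v y → y ≤v z → x ≤v z
≤v-trans = Pointwise.trans ≤-trans

≤vᵇ⇒≤v : ∀ {n} {x y : Vec ℕ n} → T (x ≤vᵇ y) → x ≤v y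
≤vᵇ⇒≤v {x = []} {[]} _ = []
≤vᵇ⇒≤v {x = a ∷ x} {b ∷ y} t with a≤b , x≤y ← Equivalence.to T-∧ t =
  ≤ᵇ⇒≤ a b a≤b ∷ ≤vᵇ⇒≤v x≤y

≤v⇒≤vᵇ : ∀ {n} {x y : Vec ℕ n} → x ≤v y → T (x ≤vᵇ y)
≤v⇒≤vᵇ [] = tt
≤v⇒≤vᵇ (a≤b ∷ x≤y) = Equivalence.from T-∧ (≤⇒≤ᵇ a≤b , ≤v⇒≤vᵇ x≤y)

≤vᵇ-reflects-≤v : ∀ {n} {x y : Vec ℕ n} → Reflects (x ≤v y) (x ≤vᵇ y)
≤vᵇ-reflects-≤v = fromEquivalence ≤vᵇ⇒≤v ≤v⇒≤vᵇ

0≤v : ∀ {n} {x : Vec ℕ n} → replicate n 0 ≤v x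
0≤v {x = []} = []
0≤v {x = _ ∷ _} = z≤n ∷ 0≤v

maxv-lub : ∀ {n} {u w y : Vec ℕ n} → u ≤v y → w ≤v y → maxv u w ≤v y
maxv-lub [] [] = []
maxv-lub (a≤e ∷ u≤y) (c≤e ∷ w≤y) = ⊔-lub a≤e c≤e ∷ maxv-lub u≤y w≤y

maxv-≤v⁻ : ∀ {n} {u w y : Vec ℕ n} → maxv u w ≤v y → u ≤v y × w ≤v y
maxv-≤v⁻ {u = []} {[]} [] = [] , []
maxv-≤v⁻ {u = a ∷ _} {c ∷ _} (a⊔c≤e ∷ max≤y) =
  let u≤y , w≤y = maxv-≤v⁻ max≤y
  in ≤-trans (m≤m⊔n a c) a⊔c≤e ∷ u≤y , ≤-trans (m≤n⊔m a c) a⊔c≤e ∷ w≤y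

maxv-≤vᵇ : ∀ {n} (u w y : Vec ℕ n) → (maxv u w ≤vᵇ y) ≡ (u ≤vᵇ y) ∧ (w ≤vᵇ y)
maxv-≤vᵇ u w y = reflects-⇔⇒≡ (≤vᵇ-reflects-≤v {x = maxv u w})
  (≤vᵇ-reflects-≤v {x = u} {y} ×-reflects ≤vᵇ-reflects-≤v {x = w} {y})
  (mk⇔ maxv-≤v⁻ (uncurry maxv-lub))

maxAll-lub : ∀ {n} {y : Vec ℕ n} S → List.All (_≤v y) S → maxAll S ≤v y
maxAll-lub [] _ = 0≤v
maxAll-lub (_ ∷ S) (x≤y List.∷ S≤y) = maxv-lub x≤y (maxAll-lub S S≤y)

sum-mono-≤v : ∀ {n} {x y : Vec ℕ n} → x ≤v y → sum x ≤ sum y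
sum-mono-≤v [] = z≤n
sum-mono-≤v (a≤b ∷ x≤y) = +-mono-≤ a≤b (sum-mono-≤v x≤y)

sum-mono-<v : ∀ {n} {x y : Vec ℕ n} → x ≤v y → x ≢ y → sum x < sum y
sum-mono-<v [] x≢y = ⊥-elim (x≢y refl)
sum-mono-<v {x = a ∷ _} {c ∷ _} (a≤c ∷ x≤y) ax≢cy with a ℕ.≟ c
... | yes refl = +-monoʳ-< a (sum-mono-<v x≤y (ax≢cy ∘ cong (a ∷_)))
... | no a≢c = +-mono-<-≤ (≤∧≢⇒< a≤c a≢c) (sum-mono-≤v x≤y)

∈-box⁻ : ∀ {n} {b x : Vec ℕ n} → x ∈ box b → x ≤v b
∈-box⁻ {b = []} {[]} _ = []
∈-box⁻ {b = b ∷ bs} x∈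
  with a , a∈ , x∈′ ← find (∈-concatMap⁻ (λ a → map (a ∷_) (box bs)) {xs = upTo (suc b)} x∈)
  with _ , z∈ , refl ← ∈-map⁻ (a ∷_) x∈′
  = ≤-pred (∈-upTo⁻ a∈) ∷ ∈-box⁻ z∈

∈-box⁺ : ∀ {n} {b x : Vec ℕ n} → x ≤v b → x ∈ box b
∈-box⁺ [] = here refl
∈-box⁺ {b = _ ∷ bs} {a ∷ _} (a≤b ∷ x≤b) =
  ∈-concatMap⁺ (λ a → map (a ∷_) (box bs))
               (lose (∈-upTo⁺ (s≤s a≤b)) (∈-map⁺ (a ∷_) (∈-box⁺ x≤b)))

∑ : ∀ {A : Set} → (A → ℤ) → List A → ℤ
∑ h xs = sumℤ (map h xs)

∑-++ : ∀ {A : Set} (h : A → ℤ) xs ys → ∑ h (xs ++ ys) ≡ ∑ h xs + ∑ h ys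
∑-++ h [] ys = sym (ℤ.+-identityˡ _)
∑-++ h (x ∷ xs) ys = trans (cong (h x +_) (∑-++ h xs ys)) (sym (ℤ.+-assoc (h x) _ _))

∑-*ˡ : ∀ {A : Set} c (h : A → ℤ) xs → ∑ (λ a → c * h a) xs ≡ c * ∑ h xs
∑-*ˡ c h [] = sym (ℤ.*-zeroʳ c)
∑-*ˡ c h (x ∷ xs) = trans (cong (c * h x +_) (∑-*ˡ c h xs)) (sym (ℤ.*-distribˡ-+ c (h x) _))

∑-cong : ∀ {A : Set} {h h′ : A → ℤ} {xs} → (∀ a → h a ≡ h′ a) → ∑ h xs ≡ ∑ h′ xs
∑-cong {xs = xs} h≗h′ = cong sumℤ (map-cong h≗h′ xs)

∑-cong-All : ∀ {A : Set} {h h′ : A → ℤ} {xs} → List.All (λ a → h a ≡ h′ a) xs → ∑ h xs ≡ ∑ h′ xs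
∑-cong-All = cong sumℤ ∘ map-cong-local

∑-sublists-∷ : ∀ {A : Set} (h : List A → ℤ) a L →
  ∑ h (sublists (a ∷ L)) ≡ ∑ h (sublists L) + ∑ (h ∘ (a ∷_)) (sublists L)
∑-sublists-∷ h a L =
  trans (∑-++ h (sublists L) _) (cong (λ t → ∑ h (sublists L) + sumℤ t) (sym (map-∘ (sublists L))))

All-sublists : ∀ {A : Set} {P : A → Set} {L : List A} → List.All P L → List.All (List.All P) (sublists L)
All-sublists List.[] = List.[] List.∷ List.[]
All-sublists (p List.∷ ps) = ++⁺ (All-sublists ps) (map⁺ (List.map (p List.∷_) (All-sublists ps)))

ind : Bool → ℤ
ind true = 1ℤ
ind false = 0ℤ

ind-∧ : ∀ a b → ind (a ∧ b) ≡ ind a * ind b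
ind-∧ true b = sym (ℤ.*-identityˡ (ind b))
ind-∧ false b = refl

if∧-then-else-0 : ∀ a e (z : ℤ) → (if a ∧ e then z else 0ℤ) ≡ (ind a * z) * ind e
if∧-then-else-0 true true z = sym (trans (ℤ.*-identityʳ _) (ℤ.*-identityˡ z))
if∧-then-else-0 true false z = sym (ℤ.*-zeroʳ (1ℤ * z))
if∧-then-else-0 false e z = refl

-- Stated with _≡ᵇ_ and _≤ᵇ_ so that it holds by computation; these reduce by recursion
-- on v, hence the three base cases.
ind-≡ᵇ-suc : ∀ {v b} → v ≤ suc b → ind (v ≡ᵇ suc b) ≡ ind (v ≤ᵇ suc b) - ind (v ≤ᵇ b)
ind-≡ᵇ-suc {zero} _ = refl
ind-≡ᵇ-suc {suc zero} {zero} _ = refl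
ind-≡ᵇ-suc {suc zero} {suc b} _ = refl
ind-≡ᵇ-suc {suc (suc v)} {suc b} (s≤s v≤b) = ind-≡ᵇ-suc {suc v} {b} v≤b

==v-∷ : ∀ {n} a b (xs ys : Vec ℕ n) → ((a ∷ xs) ==v (b ∷ ys)) ≡ (a ≡ᵇ b) ∧ (xs ==v ys)
==v-∷ a b xs ys = trans (isYes≗does _) (cong ((a ≡ᵇ b) ∧_) (sym (isYes≗does _)))

-- Mixed backward differences

-- ∇ g b = Σ_{ε ∈ {0,1}ⁿ} (−1)^|ε| g (b − ε), with truncated subtraction.
∇ : ∀ {n} → (Vec ℕ n → ℤ) → Vec ℕ n → ℤ
∇ g [] = g []
∇ g (b ∷ bs) = ∇ (λ v → g (b ∷ v)) bs - ∇ (λ v → g (b ∸ 1 ∷ v)) bs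

∇-cong-≤v : ∀ {n} {g h : Vec ℕ n → ℤ} b → (∀ x → x ≤v b → g x ≡ h x) → ∇ g b ≡ ∇ h b
∇-cong-≤v [] g≡h = g≡h [] []
∇-cong-≤v (b ∷ bs) g≡h =
  cong₂ _-_ (∇-cong-≤v bs λ x x≤bs → g≡h (b ∷ x) (≤-refl ∷ x≤bs))
            (∇-cong-≤v bs λ x x≤bs → g≡h (b ∸ 1 ∷ x) (m∸n≤m b 1 ∷ x≤bs))

∇-cong : ∀ {n} {g h : Vec ℕ n → ℤ} b → (∀ x → g x ≡ h x) → ∇ g b ≡ ∇ h b
∇-cong b g≡h = ∇-cong-≤v b λ x _ → g≡h x

∇-0 : ∀ {n} (b : Vec ℕ n) → ∇ (λ _ → 0ℤ) b ≡ 0ℤ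
∇-0 [] = refl
∇-0 (b ∷ bs) = cong₂ _-_ (∇-0 bs) (∇-0 bs)

∇-+ : ∀ {n} (g h : Vec ℕ n → ℤ) b → ∇ (λ x → g x + h x) b ≡ ∇ g b + ∇ h b
∇-+ g h [] = refl
∇-+ g h (b ∷ bs) =
  trans (cong₂ _-_ (∇-+ (λ v → g (b ∷ v)) (λ v → h (b ∷ v)) bs)
                   (∇-+ (λ v → g (b ∸ 1 ∷ v)) (λ v → h (b ∸ 1 ∷ v)) bs))
        (+-‿-interchange (∇ (λ v → g (b ∷ v)) bs) _ (∇ (λ v → g (b ∸ 1 ∷ v)) bs) _)
  where
  +-‿-interchange : ∀ a c a′ c′ → (a + c) - (a′ + c′) ≡ (a - a′) + (c - c′)
  +-‿-interchange = solve-∀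

∇-*ˡ : ∀ {n} c (g : Vec ℕ n → ℤ) b → ∇ (λ x → c * g x) b ≡ c * ∇ g b
∇-*ˡ c g [] = refl
∇-*ˡ c g (b ∷ bs) =
  trans (cong₂ _-_ (∇-*ˡ c (λ v → g (b ∷ v)) bs) (∇-*ˡ c (λ v → g (b ∸ 1 ∷ v)) bs))
        (*-distribˡ-‿- c _ _)
  where
  *-distribˡ-‿- : ∀ c a a′ → c * a - c * a′ ≡ c * (a - a′)
  *-distribˡ-‿- = solve-∀

∇-∑ : ∀ {n} {A : Set} (h : A → Vec ℕ n → ℤ) xs b →
  ∇ (λ x → ∑ (λ a → h a x) xs) b ≡ ∑ (λ a → ∇ (h a) b) xs
∇-∑ h [] b = ∇-0 b
∇-∑ h (a ∷ xs) b = trans (∇-+ (h a) _ b) (cong (∇ (h a) b +_) (∇-∑ h xs b))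

∇-upset : ∀ {n} {v b : Vec ℕ n} → v ≤v b → All (1 ≤_) b →
  ∇ (λ x → ind (v ≤vᵇ x)) b ≡ ind (v ==v b)
∇-upset {v = []} {[]} [] Vec.[] = refl
∇-upset {v = v ∷ vs} {suc b ∷ bs} (v≤b ∷ vs≤bs) (s≤s z≤n Vec.∷ bs≥1) = begin
  ∇ (λ x → ind ((v ≤ᵇ suc b) ∧ (vs ≤vᵇ x))) bs - ∇ (λ x → ind ((v ≤ᵇ b) ∧ (vs ≤vᵇ x))) bs
    ≡⟨ cong₂ _-_ (∇-ind-∧ (v ≤ᵇ suc b)) (∇-ind-∧ (v ≤ᵇ b)) ⟩
  ind (v ≤ᵇ suc b) * ind (vs ==v bs) - ind (v ≤ᵇ b) * ind (vs ==v bs)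
    ≡⟨ *-distribʳ-‿- (ind (v ≤ᵇ suc b)) (ind (v ≤ᵇ b)) _ ⟩
  (ind (v ≤ᵇ suc b) - ind (v ≤ᵇ b)) * ind (vs ==v bs)
    ≡⟨ cong (_* ind (vs ==v bs)) (sym (ind-≡ᵇ-suc v≤b)) ⟩
  ind (v ≡ᵇ suc b) * ind (vs ==v bs)
    ≡⟨ sym (ind-∧ (v ≡ᵇ suc b) (vs ==v bs)) ⟩
  ind ((v ≡ᵇ suc b) ∧ (vs ==v bs))
    ≡⟨ cong ind (sym (==v-∷ v (suc b) vs bs)) ⟩
  ind ((v ∷ vs) ==v (suc b ∷ bs)) ∎
  where
  open ≡-Reasoning
  ∇-ind-∧ : ∀ c → ∇ (λ x → ind (c ∧ (vs ≤vᵇ x))) bs ≡ ind c * ind (vs ==v bs)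
  ∇-ind-∧ c = begin
    ∇ (λ x → ind (c ∧ (vs ≤vᵇ x))) bs ≡⟨ ∇-cong bs (λ x → ind-∧ c (vs ≤vᵇ x)) ⟩
    ∇ (λ x → ind c * ind (vs ≤vᵇ x)) bs ≡⟨ ∇-*ˡ (ind c) _ bs ⟩
    ind c * ∇ (λ x → ind (vs ≤vᵇ x)) bs ≡⟨ cong (ind c *_) (∇-upset vs≤bs bs≥1) ⟩
    ind c * ind (vs ==v bs) ∎
  *-distribʳ-‿- : ∀ a a′ c → a * c - a′ * c ≡ (a - a′) * c
  *-distribʳ-‿- = solve-∀

-- Formations and inclusion–exclusion

sgn : ∀ {A : Set} → List A → ℤ
sgn S = if isOdd (length S) then 1ℤ else -1ℤ

sgn-∷ : ∀ {A : Set} (a : A) S → sgn (a ∷ S) ≡ - sgn S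
sgn-∷ a S with isOdd (length S)
... | true = refl
... | false = refl

formationSign : ∀ {A : Set} → List A → ℤ
formationSign S = ind (isNonEmpty S) * sgn S

signedUpset : ∀ {n} → List (Vec ℕ n) → Vec ℕ n → ℤ
signedUpset S x = formationSign S * ind (maxAll S ≤vᵇ x)

contribution-∇ : ∀ {n} {b : Vec ℕ n} S → maxAll S ≤v b → All (1 ≤_) b →
  contribution b S ≡ ∇ (signedUpset S) b
contribution-∇ {b = b} S S≤b b≥1 = begin
  contribution b S
    ≡⟨ if∧-then-else-0 (isNonEmpty S) (maxAll S ==v b) (sgn S) ⟩
  formationSign S * ind (maxAll S ==v b)
    ≡⟨ cong (formationSign S *_) (sym (∇-upset S≤b b≥1)) ⟩
  formationSign S * ∇ (λ x → ind (maxAll S ≤vᵇ x)) b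
    ≡⟨ sym (∇-*ˡ (formationSign S) _ b) ⟩
  ∇ (signedUpset S) b ∎
  where open ≡-Reasoning

module _ {n} (y : Vec ℕ n) where

  alternatingUpsetSum : List (Vec ℕ n) → ℤ
  alternatingUpsetSum L = ∑ (λ S → sgn S * ind (maxAll S ≤vᵇ y)) (sublists L)

  ∑-extensions : ∀ a L →
    ∑ (λ S → sgn (a ∷ S) * ind (maxAll (a ∷ S) ≤vᵇ y)) (sublists L)
      ≡ - ind (a ≤vᵇ y) * alternatingUpsetSum L
  ∑-extensions a L = trans (∑-cong {xs = sublists L} term-∷) (∑-*ˡ (- ind (a ≤vᵇ y)) _ (sublists L))
    where
    -‿*-swap : ∀ s A B → - s * (A * B) ≡ - A * (s * B)
    -‿*-swap = solve-∀
    term-∷ : ∀ S → sgn (a ∷ S) * ind (maxAll (a ∷ S) ≤vᵇ y)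
                 ≡ - ind (a ≤vᵇ y) * (sgn S * ind (maxAll S ≤vᵇ y))
    term-∷ S = trans (cong₂ _*_ (sgn-∷ a S) (trans (cong ind (maxv-≤vᵇ a (maxAll S) y))
                                                   (ind-∧ (a ≤vᵇ y) (maxAll S ≤vᵇ y))))
                     (-‿*-swap (sgn S) (ind (a ≤vᵇ y)) (ind (maxAll S ≤vᵇ y)))

  alternatingUpsetSum-any : ∀ L → alternatingUpsetSum L ≡ ind (any (_≤vᵇ y) L) - 1ℤ
  alternatingUpsetSum-any [] = cong (λ t → -1ℤ * ind t + 0ℤ) (Equivalence.to T-≡ (≤v⇒≤vᵇ (0≤v {x = y})))
  alternatingUpsetSum-any (a ∷ L) = begin
    alternatingUpsetSum (a ∷ L)
      ≡⟨ ∑-sublists-∷ _ a L ⟩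
    alternatingUpsetSum L + ∑ (λ S → sgn (a ∷ S) * ind (maxAll (a ∷ S) ≤vᵇ y)) (sublists L)
      ≡⟨ cong (alternatingUpsetSum L +_) (∑-extensions a L) ⟩
    alternatingUpsetSum L + - ind (a ≤vᵇ y) * alternatingUpsetSum L
      ≡⟨ cong (λ t → t + - ind (a ≤vᵇ y) * t) (alternatingUpsetSum-any L) ⟩
    (ind B - 1ℤ) + - ind (a ≤vᵇ y) * (ind B - 1ℤ)
      ≡⟨ ∨-step (a ≤vᵇ y) B ⟩
    ind ((a ≤vᵇ y) ∨ B) - 1ℤ ∎
    where
    open ≡-Reasoning
    B = any (_≤vᵇ y) L
    ∨-step : ∀ p q → (ind q - 1ℤ) + - ind p * (ind q - 1ℤ) ≡ ind (p ∨ q) - 1ℤ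
    ∨-step true true = refl
    ∨-step true false = refl
    ∨-step false true = refl
    ∨-step false false = refl

  inclusion–exclusion : ∀ L → ∑ (λ S → signedUpset S y) (sublists L) ≡ ind (any (_≤vᵇ y) L)
  inclusion–exclusion [] = refl
  inclusion–exclusion (a ∷ L) = begin
    ∑ (λ S → signedUpset S y) (sublists (a ∷ L))
      ≡⟨ ∑-sublists-∷ _ a L ⟩
    ∑ (λ S → signedUpset S y) (sublists L) + ∑ (λ S → signedUpset (a ∷ S) y) (sublists L)
      ≡⟨ cong₂ _+_ (inclusion–exclusion L) (∑-cong {xs = sublists L} λ S →
           cong (_* ind (maxAll (a ∷ S) ≤vᵇ y)) (ℤ.*-identityˡ (sgn (a ∷ S)))) ⟩
    ind B + ∑ (λ S → sgn (a ∷ S) * ind (maxAll (a ∷ S) ≤vᵇ y)) (sublists L)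
      ≡⟨ cong (ind B +_) (trans (∑-extensions a L)
                                (cong (- ind (a ≤vᵇ y) *_) (alternatingUpsetSum-any L))) ⟩
    ind B + - ind (a ≤vᵇ y) * (ind B - 1ℤ)
      ≡⟨ ∨-step (a ≤vᵇ y) B ⟩
    ind ((a ≤vᵇ y) ∨ B) ∎
    where
    open ≡-Reasoning
    B = any (_≤vᵇ y) L
    ∨-step : ∀ p q → ind q + - ind p * (ind q - 1ℤ) ≡ ind (p ∨ q)
    ∨-step true true = refl
    ∨-step true false = refl
    ∨-step false true = refl
    ∨-step false false = refl

-- Minimal path vectors

MonotoneOn : ∀ {n} → (Vec ℕ n → Bool) → Vec ℕ n → Set
MonotoneOn f b = ∀ x y → x ≤v y → y ≤v b → T (f x) → T (f y)

module _ {n} {f : Vec ℕ n → Bool} {b : Vec ℕ n} where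

  ∈-minPaths⁻ : ∀ {p} → p ∈ minPaths f b → p ≤v b × T (f p)
  ∈-minPaths⁻ p∈ with p∈box , minimal ← ∈-filter⁻ (λ x → isMinPath f b x Bool.≟ true) {xs = box b} p∈ =
    ∈-box⁻ p∈box , proj₁ (Equivalence.to T-∧ (Equivalence.from T-≡ minimal))

  smallerPath : Vec ℕ n → Vec ℕ n → Bool
  smallerPath x y = (y ≤vᵇ x) ∧ not (y ==v x) ∧ f y

  minPath-below : ∀ x → x ≤v b → T (f x) → ∃[ p ] p ∈ minPaths f b × p ≤v x
  minPath-below x = go x (<-wellFounded (sum x))
    where
    go : ∀ x → Acc _<_ (sum x) → x ≤v b → T (f x) → ∃[ p ] p ∈ minPaths f b × p ≤v x
    go x (acc smaller) x≤b fx with any? (λ y → T? (smallerPath x y)) (box b)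
    ... | yes ∃smaller
      with y , _ , t ← find ∃smaller
      with y≤x , t′ ← Equivalence.to T-∧ t
      with y≢x , fy ← Equivalence.to T-∧ t′
      with p , p∈ , p≤y ← go y (smaller (sum-mono-<v (≤vᵇ⇒≤v y≤x) (T-not⇒¬T y≢x ∘ fromWitness)))
                             (≤v-trans (≤vᵇ⇒≤v y≤x) x≤b) fy
      = p , p∈ , ≤v-trans p≤y (≤vᵇ⇒≤v y≤x)
    ... | no ∄smaller = x , ∈-filter⁺ (λ x → isMinPath f b x Bool.≟ true) (∈-box⁺ x≤b) minimal , ≤v-refl
      where
      minimal : isMinPath f b x ≡ true
      minimal = Equivalence.to T-≡ (Equivalence.from T-∧
        (fx , All⇒allB (List.map ¬T⇒T-not (¬Any⇒All¬ (box b) ∄smaller))))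

  any-minPaths : MonotoneOn f b → ∀ {x} → x ≤v b → any (_≤vᵇ x) (minPaths f b) ≡ f x
  any-minPaths monotone {x} x≤b = reflects-⇔⇒≡ (T-reflects _) (T-reflects _) (mk⇔ to from)
    where
    to : T (any (_≤vᵇ x) (minPaths f b)) → T (f x)
    to t with p , p∈ , p≤x ← find (any⁻ (_≤vᵇ x) (minPaths f b) t) =
      monotone p x (≤vᵇ⇒≤v p≤x) x≤b (proj₂ (∈-minPaths⁻ p∈))
    from : T (f x) → T (any (_≤vᵇ x) (minPaths f b))
    from fx with p , p∈ , p≤x ← minPath-below x x≤b fx = any⁺ (_≤vᵇ x) (lose p∈ (≤v⇒≤vᵇ p≤x))

  d≡∇ : MonotoneOn f b → All (1 ≤_) b → d f b ≡ ∇ (ind ∘ f) b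
  d≡∇ monotone b≥1 = begin
    ∑ (contribution b) (sublists (minPaths f b))
      ≡⟨ ∑-cong-All (List.map (λ {S} S≤b → contribution-∇ S (maxAll-lub S S≤b) b≥1)
                               (All-sublists (List.tabulate (proj₁ ∘ ∈-minPaths⁻)))) ⟩
    ∑ (λ S → ∇ (signedUpset S) b) (sublists (minPaths f b))
      ≡⟨ sym (∇-∑ signedUpset (sublists (minPaths f b)) b) ⟩
    ∇ (λ x → ∑ (λ S → signedUpset S x) (sublists (minPaths f b))) b
      ≡⟨ ∇-cong-≤v b (λ x x≤b → trans (inclusion–exclusion x (minPaths f b))
                                       (cong ind (any-minPaths monotone x≤b))) ⟩
    ∇ (ind ∘ f) b ∎
    where open ≡-Reasoning

shiftBy : ∀ {n} → Vec ℕ n → Vec ℕ n → Vec ℕ n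
shiftBy m z = zipWith (λ a c → (a ∸ 1) ℕ.+ c) m z

shiftBy-mono : ∀ {n} (m : Vec ℕ n) {z z′} → z ≤v z′ → shiftBy m z ≤v shiftBy m z′
shiftBy-mono [] [] = []
shiftBy-mono (a ∷ m) (c≤c′ ∷ z≤z′) = +-monoʳ-≤ (a ∸ 1) c≤c′ ∷ shiftBy-mono m z≤z′

shiftBy-≤v : ∀ {n} {m z : Vec ℕ n} → All (1 ≤_) m → z ≤v replicate n 1 → shiftBy m z ≤v m
shiftBy-≤v Vec.[] [] = []
shiftBy-≤v {m = suc a ∷ _} (s≤s z≤n Vec.∷ m≥1) (c≤1 ∷ z≤1) =
  ≤-trans (+-monoʳ-≤ a c≤1) (≤-reflexive (+-comm a 1)) ∷ shiftBy-≤v m≥1 z≤1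

∇-shiftBy : ∀ {n} {m : Vec ℕ n} → All (1 ≤_) m → ∀ (g : Vec ℕ n → ℤ) →
  ∇ g m ≡ ∇ (g ∘ shiftBy m) (replicate n 1)
∇-shiftBy Vec.[] g = refl
∇-shiftBy {n = suc n} {suc a ∷ m} (s≤s z≤n Vec.∷ m≥1) g =
  cong₂ _-_ (trans (∇-shiftBy m≥1 _) (∇-cong (replicate n 1) (head-cong (+-comm 1 a))))
            (trans (∇-shiftBy m≥1 _) (∇-cong (replicate n 1) (head-cong (sym (+-identityʳ a)))))
  where
  head-cong : ∀ {c c′} → c ≡ c′ → ∀ z → g (c ∷ shiftBy m z) ≡ g (c′ ∷ shiftBy m z)
  head-cong c≡c′ z = cong (λ t → g (t ∷ shiftBy m z)) c≡c′

All-replicate : ∀ {P : ℕ → Set} {c} n → P c → All P (replicate n c)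
All-replicate zero _ = Vec.[]
All-replicate (suc n) pc = pc Vec.∷ All-replicate n pc

theorem5p1 : (n : ℕ) (m : Vec ℕ n) → All (1 ≤_) m →
    (M : ℕ) (φ : Vec ℕ n → ℕ) →
    (∀ x → x ≤v m → φ x ≤ M) →
    (∀ x y → x ≤v y → y ≤v m → φ x ≤ φ y) →
    (k : ℕ) → 1 ≤ k → k ≤ M →
    d (φ[ k ] φ) m ≡ d (ψ[ k ] φ m) (replicate n 1)
theorem5p1 n m m≥1 _ φ _ φ-mono k _ _ = begin
  d (φ[ k ] φ) m                                  ≡⟨ d≡∇ φₖ-mono m≥1 ⟩
  ∇ (ind ∘ φ[ k ] φ) m                            ≡⟨ ∇-shiftBy m≥1 (ind ∘ φ[ k ] φ) ⟩
  ∇ (ind ∘ ψ[ k ] φ m) (replicate n 1)            ≡⟨ sym (d≡∇ ψₖ-mono (All-replicate n (s≤s z≤n))) ⟩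
  d (ψ[ k ] φ m) (replicate n 1)                  ∎
  where
  open ≡-Reasoning
  φₖ-mono : MonotoneOn (φ[ k ] φ) m
  φₖ-mono x y x≤y y≤m t = ≤⇒≤ᵇ (≤-trans (≤ᵇ⇒≤ k (φ x) t) (φ-mono x y x≤y y≤m))
  ψₖ-mono : MonotoneOn (ψ[ k ] φ m) (replicate n 1)
  ψₖ-mono z z′ z≤z′ z′≤1 = φₖ-mono _ _ (shiftBy-mono m z≤z′) (shiftBy-≤v m≥1 z′≤1)
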